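{- Let $t,u$ be terms, $k\in\mathbb{N}$, and $\vec{x}=(x_1,\dots,x_k)$ a list of pairwise distinct variables with $\mathrm{Fv}(t)\cup\mathrm{Fv}(u)\subseteq\{x_1,\dots,x_k\}$. If $t\simeq_{\mathsf{shuf}}u$ then $[\![t]\!]_{\vec{x}}=[\![u]\!]_{\vec{x}}$.
   Context: Terms: $t ::= x \mid \lambda x.t \mid tu$ (up to $\alpha$); values $v ::= x \mid \lambda x.t$; $\mathrm{Fv}(t)$ free variables; $t\{v/x\}$ substitution. Root steps: ($\beta_v$) $(\lambda x.t)v \mapsto t\{v/x\}$, $v$ a value; ($\sigma_1$) $(\lambda x.t)us \mapsto (\lambda x.ts)u$ if $x\notin\mathrm{Fv}(s)$; ($\sigma_3$) $v((\lambda x.s)u)\mapsto(\lambda x.vs)u$ if $v$ a value, $x\notin\mathrm{Fv}(v)$. $\mathsf{shuf}$-reduction is the closure of the union of these root steps under arbitrary term contexts (including under $\lambda$), and $\simeq_{\mathsf{shuf}}$ its reflexive-symmetric-transitive closure. Types: positive types are finite multisets $[(P_1,Q_1),\dots,(P_n,Q_n)]$ of pairs of positive types ($\mathbf{0}$ empty, $\uplus$ union). Environments map variables to positive types (finitely many non-$\mathbf{0}$), combined pointwise by $\uplus$. Rules: (ax) $x\colon P\vdash x\colon P$; ($\lambda$) from $\Gamma_i,x\colon P_i\vdash t\colon Q_i$ ($1\le i\le n$, $n\ge0$) infer $\biguplus_i\Gamma_i\vdash\lambda x.t\colon[(P_1,Q_1),\dots,(P_n,Q_n)]$; ($@$) from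 $\Gamma\vdash t\colon[(P,Q)]$ and $\Delta\vdash u\colon P$ infer $\Gamma\uplus\Delta\vdash tu\colon Q$. Relational semantics: $[\![t]\!]_{\vec{x}}=\{((P_1,\dots,P_k),Q)\mid x_1\colon P_1,\dots,x_k\colon P_k\vdash t\colon Q\text{ derivable}\}$. -}

module Defs where

open import Data.Nat using (ℕ; zero; suc)
open import Data.Fin using (Fin; zero; suc)
open import Data.List using (List; []; _∷_; _++_; [_])
open import Data.Vec using (Vec; []; _∷_; replicate; zipWith; _[_]≔_)
open import Data.Product using (_×_; _,_; Σ; ∃-syntax)
open import Data.List.Relation.Binary.Permutation.Homogeneous using (Permutation)
open import Data.Vec.Relation.Binary.Pointwise.Inductive using (Pointwise)
open import Relation.Binary.Construct.Closure.Equivalence using (EqClosure)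

-- Terms (well-scoped de Bruijn: Term n = terms with free vars among n)

data Term (n : ℕ) : Set where
  var : Fin n → Term n
  ƛ_  : Term (suc n) → Term n
  _·_ : Term n → Term n → Term n

infixl 7 _·_
infix  5 ƛ_

data Value {n : ℕ} : Term n → Set where
  var-val : (i : Fin n) → Value (var i)
  lam-val : (t : Term (suc n)) → Value (ƛ t)

ext : ∀ {m n} → (Fin m → Fin n) → Fin (suc m) → Fin (suc n)
ext ρ zero    = zero
ext ρ (suc i) = suc (ρ i)

rename : ∀ {m n} → (Fin m → Fin n) → Term m → Term n
rename ρ (var i) = var (ρ i)
rename ρ (ƛ t)   = ƛ rename (ext ρ) t
rename ρ (t · u) = rename ρ t · rename ρ u

weaken : ∀ {n} → Term n → Term (suc n)
weaken = rename suc

exts : ∀ {m n} → (Fin m → Term n) → Fin (suc m) → Term (suc n)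
exts σ zero    = var zero
exts σ (suc i) = weaken (σ i)

subst : ∀ {m n} → (Fin m → Term n) → Term m → Term n
subst σ (var i) = σ i
subst σ (ƛ t)   = ƛ subst (exts σ) t
subst σ (t · u) = subst σ t · subst σ u

-- t{v/x} where x is the variable bound by the enclosing λ (index 0)
_⟨_⟩ : ∀ {n} → Term (suc n) → Term n → Term n
t ⟨ v ⟩ = subst σ t
  where
  σ : _ → _
  σ zero    = v
  σ (suc i) = var i

data _↦_ {n : ℕ} : Term n → Term n → Set where
  βv : ∀ (t : Term (suc n)) (v : Term n) → Value v → ((ƛ t) · v) ↦ (t ⟨ v ⟩)
  -- (λx.t) u s ↦ (λx.t s) u, with x ∉ Fv(s)  (s is weakened)
  σ₁ : ∀ (t : Term (suc n)) (u s : Term n) →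
       ((ƛ t) · u · s) ↦ ((ƛ (t · weaken s)) · u)
  -- v ((λx.s) u) ↦ (λx. v s) u, with v a value and x ∉ Fv(v)
  σ₃ : ∀ (v : Term n) (s : Term (suc n)) (u : Term n) → Value v →
       (v · ((ƛ s) · u)) ↦ ((ƛ (weaken v · s)) · u)

data _→shuf_ : ∀ {n} → Term n → Term n → Set where
  root : ∀ {n} {t t′ : Term n} → t ↦ t′ → t →shuf t′
  ξλ   : ∀ {n} {t t′ : Term (suc n)} → t →shuf t′ → (ƛ t) →shuf (ƛ t′)
  ξ·l  : ∀ {n} {t t′ u : Term n} → t →shuf t′ → (t · u) →shuf (t′ · u)
  ξ·r  : ∀ {n} {t u u′ : Term n} → u →shuf u′ → (t · u) →shuf (t · u′)

_≃shuf_ : ∀ {n} → Term n → Term n → Set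
_≃shuf_ = EqClosure _→shuf_

-- Positive types: finite multisets of pairs of positive types,
-- represented by lists, considered up to (nested) multiset equality _≈_.

data Pos : Set where
  mset : List (Pos × Pos) → Pos

𝟘 : Pos
𝟘 = mset []

_⊎ₚ_ : Pos → Pos → Pos
mset xs ⊎ₚ mset ys = mset (xs ++ ys)

mutual
  data _≈_ : Pos → Pos → Set where
    mset≈ : ∀ {xs ys} → Permutation _≈²_ xs ys → mset xs ≈ mset ys

  data _≈²_ : Pos × Pos → Pos × Pos → Set where
    pair≈ : ∀ {P P′ Q Q′} → P ≈ P′ → Q ≈ Q′ → (P , Q) ≈² (P′ , Q′)

Env : ℕ → Set
Env n = Vec Pos n

𝟘ₑ : ∀ {n} → Env n
𝟘ₑ = replicate _ 𝟘

_⊎ₑ_ : ∀ {n} → Env n → Env n → Env n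
_⊎ₑ_ = zipWith _⊎ₚ_

_≈ₑ_ : ∀ {n} → Env n → Env n → Set
_≈ₑ_ = Pointwise _≈_

mutual
  data _⊢_∶_ {n : ℕ} : Env n → Term n → Pos → Set where
    ax  : ∀ (i : Fin n) (P : Pos) → (𝟘ₑ [ i ]≔ P) ⊢ var i ∶ P
    lam : ∀ {Γ t ps} → Γ ⊢λ t ∶ ps → Γ ⊢ (ƛ t) ∶ mset ps
    app : ∀ {Γ Δ t u P P′ Q} → Γ ⊢ t ∶ mset [ (P , Q) ] → Δ ⊢ u ∶ P′ → P ≈ P′ →
          (Γ ⊎ₑ Δ) ⊢ (t · u) ∶ Q

  -- the n ≥ 0 premises Γᵢ , x : Pᵢ ⊢ t : Qᵢ of rule (λ)
  data _⊢λ_∶_ {n : ℕ} : Env n → Term (suc n) → List (Pos × Pos) → Set where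
    nil  : ∀ {t} → 𝟘ₑ ⊢λ t ∶ []
    cons : ∀ {Γ Δ t P Q ps} → (P ∷ Γ) ⊢ t ∶ Q → Δ ⊢λ t ∶ ps →
           (Γ ⊎ₑ Δ) ⊢λ t ∶ ((P , Q) ∷ ps)

-- Relational semantics: ⟦ t ⟧ (P₁,…,Pₖ) Q  iff  ((P₁,…,Pₖ),Q) ∈ [[t]]_x⃗,
-- where types/environments are read as multisets (up to _≈_).

⟦_⟧ : ∀ {k} → Term k → Env k → Pos → Set
⟦ t ⟧ Γ Q = ∃[ Γ′ ] ∃[ Q′ ] (Γ ≈ₑ Γ′ × Q ≈ Q′ × Γ′ ⊢ t ∶ Q′)

{-# OPTIONS --safe #-}
module Submission where

-- Typing is compositional up to multiset equality: a variable, an application or an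
-- abstraction is typable iff its environment splits into environments typing its parts.
-- So semantic equivalence is a congruence, and σ₁, σ₃ merely reassociate such splittings,
-- a weakened term being typable exactly when the fresh variable gets type 𝟘.  For βv the
-- point is that values, like variables, are duplicable and erasable: v has type P ⊎ P′
-- iff its environment splits into environments giving v the types P and P′, and type 𝟘
-- iff its environment is empty.  Hence substituting v for the occurrences of x in t
-- matches the splitting of the environment in the typing of (λx.t)v.

open import Data.Nat using (ℕ; zero; suc)
open import Data.Fin using (Fin; zero; suc)
open import Data.List using (List; []; _∷_; _++_; [_])
open import Data.Vec using ([]; _∷_; _[_]≔_)
open import Data.Product using (_×_; _,_; ∃-syntax)
open import Function using (_∘_; id)
open import Function.Bundles using (_⇔_; mk⇔; Equivalence)
open import Relation.Binary.PropositionalEquality using (_≡_; refl)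
open import Relation.Binary.Bundles using (Setoid)
open import Relation.Binary.Structures using (IsEquivalence)
open import Relation.Binary.Construct.Closure.Equivalence using (fold)
open import Algebra.Bundles using (CommutativeMonoid)
open import Data.List.Relation.Binary.Permutation.Homogeneous as Perm
  using (Permutation; prep; swap; trans)
open import Data.List.Relation.Binary.Pointwise.Base as ListPw using ([]; _∷_)
open import Data.Vec.Relation.Binary.Pointwise.Inductive as VecPw using ([]; _∷_)
import Data.List.Relation.Binary.Permutation.Setoid.Properties as PermProperties
import Algebra.Properties.CommutativeSemigroup as CommSemigroupProperties
open import Function.Properties.Equivalence using (⇔-isEquivalence)

open import Defs

mutual
  ≈-refl : ∀ {P} → P ≈ P
  ≈-refl {mset xs} = mset≈ (Perm.refl (≋-refl xs))

  ≋-refl : ∀ xs → ListPw.Pointwise _≈²_ xs xs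
  ≋-refl []             = []
  ≋-refl ((P , Q) ∷ xs) = pair≈ ≈-refl ≈-refl ∷ ≋-refl xs

mutual
  ≈-sym : ∀ {P Q} → P ≈ Q → Q ≈ P
  ≈-sym (mset≈ p) = mset≈ (↭-sym p)

  ≈²-sym : ∀ {x y} → x ≈² y → y ≈² x
  ≈²-sym (pair≈ p q) = pair≈ (≈-sym p) (≈-sym q)

  ↭-sym : ∀ {xs ys} → Permutation _≈²_ xs ys → Permutation _≈²_ ys xs
  ↭-sym (Perm.refl xs≋ys)  = Perm.refl (≋-sym xs≋ys)
  ↭-sym (prep e p)         = prep (≈²-sym e) (↭-sym p)
  ↭-sym (swap e₁ e₂ p)     = swap (≈²-sym e₂) (≈²-sym e₁) (↭-sym p)
  ↭-sym (trans p q)        = trans (↭-sym q) (↭-sym p)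

  ≋-sym : ∀ {xs ys} → ListPw.Pointwise _≈²_ xs ys → ListPw.Pointwise _≈²_ ys xs
  ≋-sym []       = []
  ≋-sym (e ∷ es) = ≈²-sym e ∷ ≋-sym es

≈-trans : ∀ {P Q R} → P ≈ Q → Q ≈ R → P ≈ R
≈-trans (mset≈ p) (mset≈ q) = mset≈ (trans p q)

≈²-refl : ∀ {x} → x ≈² x
≈²-refl = pair≈ ≈-refl ≈-refl

≈²-trans : ∀ {x y z} → x ≈² y → y ≈² z → x ≈² z
≈²-trans (pair≈ p q) (pair≈ p′ q′) = pair≈ (≈-trans p p′) (≈-trans q q′)

≈²-setoid : Setoid _ _
≈²-setoid = record
  { _≈_           = _≈²_
  ; isEquivalence = record { refl = ≈²-refl ; sym = ≈²-sym ; trans = ≈²-trans }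
  }

private
  module ↭ = PermProperties ≈²-setoid

⊎ₚ-cong : ∀ {P P′ Q Q′} → P ≈ P′ → Q ≈ Q′ → (P ⊎ₚ Q) ≈ (P′ ⊎ₚ Q′)
⊎ₚ-cong (mset≈ p) (mset≈ q) = mset≈ (↭.++⁺ p q)

⊎ₚ-assoc : ∀ P Q R → ((P ⊎ₚ Q) ⊎ₚ R) ≈ (P ⊎ₚ (Q ⊎ₚ R))
⊎ₚ-assoc (mset xs) (mset ys) (mset zs) = mset≈ (↭.++-assoc xs ys zs)

⊎ₚ-comm : ∀ P Q → (P ⊎ₚ Q) ≈ (Q ⊎ₚ P)
⊎ₚ-comm (mset xs) (mset ys) = mset≈ (↭.++-comm xs ys)

⊎ₚ-identityˡ : ∀ P → (𝟘 ⊎ₚ P) ≈ P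
⊎ₚ-identityˡ (mset xs) = ≈-refl

⊎ₚ-identityʳ : ∀ P → (P ⊎ₚ 𝟘) ≈ P
⊎ₚ-identityʳ (mset xs) = mset≈ (↭.++-identityʳ xs)

≈-⊎ₚ-𝟘ˡ : ∀ {P P₁ P₂} → P ≈ (P₁ ⊎ₚ P₂) → P₁ ≈ 𝟘 → P ≈ P₂
≈-⊎ₚ-𝟘ˡ P≈ P₁≈𝟘 = ≈-trans P≈ (≈-trans (⊎ₚ-cong P₁≈𝟘 ≈-refl) (⊎ₚ-identityˡ _))

≈-⊎ₚ-𝟘ʳ : ∀ {P P₁ P₂} → P ≈ (P₁ ⊎ₚ P₂) → P₂ ≈ 𝟘 → P ≈ P₁
≈-⊎ₚ-𝟘ʳ P≈ P₂≈𝟘 = ≈-trans P≈ (≈-trans (⊎ₚ-cong ≈-refl P₂≈𝟘) (⊎ₚ-identityʳ _))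

module _ {n : ℕ} where

  ≈ₑ-refl : {Γ : Env n} → Γ ≈ₑ Γ
  ≈ₑ-refl = VecPw.refl ≈-refl

  ≈ₑ-sym : {Γ Δ : Env n} → Γ ≈ₑ Δ → Δ ≈ₑ Γ
  ≈ₑ-sym = VecPw.sym ≈-sym

  ≈ₑ-trans : {Γ Δ Θ : Env n} → Γ ≈ₑ Δ → Δ ≈ₑ Θ → Γ ≈ₑ Θ
  ≈ₑ-trans = VecPw.trans ≈-trans

⊎ₑ-cong : ∀ {n} {Γ Γ′ Δ Δ′ : Env n} → Γ ≈ₑ Γ′ → Δ ≈ₑ Δ′ → (Γ ⊎ₑ Δ) ≈ₑ (Γ′ ⊎ₑ Δ′)
⊎ₑ-cong []       []       = []
⊎ₑ-cong (p ∷ ps) (q ∷ qs) = ⊎ₚ-cong p q ∷ ⊎ₑ-cong ps qs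

⊎ₑ-assoc : ∀ {n} (Γ Δ Θ : Env n) → ((Γ ⊎ₑ Δ) ⊎ₑ Θ) ≈ₑ (Γ ⊎ₑ (Δ ⊎ₑ Θ))
⊎ₑ-assoc []      []      []      = []
⊎ₑ-assoc (P ∷ Γ) (Q ∷ Δ) (R ∷ Θ) = ⊎ₚ-assoc P Q R ∷ ⊎ₑ-assoc Γ Δ Θ

⊎ₑ-comm : ∀ {n} (Γ Δ : Env n) → (Γ ⊎ₑ Δ) ≈ₑ (Δ ⊎ₑ Γ)
⊎ₑ-comm []      []      = []
⊎ₑ-comm (P ∷ Γ) (Q ∷ Δ) = ⊎ₚ-comm P Q ∷ ⊎ₑ-comm Γ Δ

⊎ₑ-identityˡ : ∀ {n} (Γ : Env n) → (𝟘ₑ ⊎ₑ Γ) ≈ₑ Γ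
⊎ₑ-identityˡ []      = []
⊎ₑ-identityˡ (P ∷ Γ) = ⊎ₚ-identityˡ P ∷ ⊎ₑ-identityˡ Γ

⊎ₑ-identityʳ : ∀ {n} (Γ : Env n) → (Γ ⊎ₑ 𝟘ₑ) ≈ₑ Γ
⊎ₑ-identityʳ []      = []
⊎ₑ-identityʳ (P ∷ Γ) = ⊎ₚ-identityʳ P ∷ ⊎ₑ-identityʳ Γ

≈ₑ-⊎ₑ-𝟘ˡ : ∀ {n} {Γ Γ₁ Γ₂ : Env n} → Γ ≈ₑ (Γ₁ ⊎ₑ Γ₂) → Γ₁ ≈ₑ 𝟘ₑ → Γ ≈ₑ Γ₂
≈ₑ-⊎ₑ-𝟘ˡ Γ≈ Γ₁≈𝟘 = ≈ₑ-trans Γ≈ (≈ₑ-trans (⊎ₑ-cong Γ₁≈𝟘 ≈ₑ-refl) (⊎ₑ-identityˡ _))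

≈ₑ-⊎ₑ-𝟘ʳ : ∀ {n} {Γ Γ₁ Γ₂ : Env n} → Γ ≈ₑ (Γ₁ ⊎ₑ Γ₂) → Γ₂ ≈ₑ 𝟘ₑ → Γ ≈ₑ Γ₁
≈ₑ-⊎ₑ-𝟘ʳ Γ≈ Γ₂≈𝟘 = ≈ₑ-trans Γ≈ (≈ₑ-trans (⊎ₑ-cong ≈ₑ-refl Γ₂≈𝟘) (⊎ₑ-identityʳ _))

⊎ₑ-commutativeMonoid : ℕ → CommutativeMonoid _ _
⊎ₑ-commutativeMonoid n = record
  { Carrier = Env n ; _≈_ = _≈ₑ_ ; _∙_ = _⊎ₑ_ ; ε = 𝟘ₑ
  ; isCommutativeMonoid = record
    { isMonoid = record
      { isSemigroup = record
        { isMagma = record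
          { isEquivalence = record { refl = ≈ₑ-refl ; sym = ≈ₑ-sym ; trans = ≈ₑ-trans }
          ; ∙-cong        = ⊎ₑ-cong
          }
        ; assoc = ⊎ₑ-assoc
        }
      ; identity = ⊎ₑ-identityˡ , ⊎ₑ-identityʳ
      }
    ; comm = ⊎ₑ-comm
    }
  }

module _ {n : ℕ} where
  open CommSemigroupProperties
    (CommutativeMonoid.commutativeSemigroup (⊎ₑ-commutativeMonoid n)) public
    using ()
    renaming (interchange to ⊎ₑ-interchange; x∙yz≈y∙xz to ⊎ₑ-leftSwap; xy∙z≈xz∙y to ⊎ₑ-rightSwap)

-- Inversion and introduction for the relational semantics

⟦⟧-resp : ∀ {n} {t : Term n} {Γ Γ′ Q Q′} → Γ ≈ₑ Γ′ → Q ≈ Q′ → ⟦ t ⟧ Γ Q → ⟦ t ⟧ Γ′ Q′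
⟦⟧-resp Γ≈Γ′ Q≈Q′ (Δ , R , Γ≈Δ , Q≈R , d) =
  Δ , R , ≈ₑ-trans (≈ₑ-sym Γ≈Γ′) Γ≈Δ , ≈-trans (≈-sym Q≈Q′) Q≈R , d

⟦⟧-respₑ : ∀ {n} {t : Term n} {Γ Γ′ Q} → Γ ≈ₑ Γ′ → ⟦ t ⟧ Γ Q → ⟦ t ⟧ Γ′ Q
⟦⟧-respₑ Γ≈Γ′ = ⟦⟧-resp Γ≈Γ′ ≈-refl

upd-cong : ∀ {n} (i : Fin n) {P P′} → P ≈ P′ → (𝟘ₑ [ i ]≔ P) ≈ₑ (𝟘ₑ [ i ]≔ P′)
upd-cong zero    p = p ∷ ≈ₑ-refl
upd-cong (suc i) p = ≈-refl ∷ upd-cong i p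

upd-𝟘 : ∀ {n} (i : Fin n) → (𝟘ₑ [ i ]≔ 𝟘) ≈ₑ 𝟘ₑ
upd-𝟘 zero    = ≈ₑ-refl
upd-𝟘 (suc i) = ≈-refl ∷ upd-𝟘 i

upd-⊎ₚ : ∀ {n} (i : Fin n) P P′ →
         (𝟘ₑ [ i ]≔ (P ⊎ₚ P′)) ≈ₑ ((𝟘ₑ [ i ]≔ P) ⊎ₑ (𝟘ₑ [ i ]≔ P′))
upd-⊎ₚ zero    P P′ = ≈-refl ∷ ≈ₑ-sym (⊎ₑ-identityˡ 𝟘ₑ)
upd-⊎ₚ (suc i) P P′ = ≈-refl ∷ upd-⊎ₚ i P P′

⟦var⟧⁻ : ∀ {n} {i : Fin n} {Γ Q} → ⟦ var i ⟧ Γ Q → Γ ≈ₑ (𝟘ₑ [ i ]≔ Q)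
⟦var⟧⁻ {i = i} (_ , _ , Γ≈ , Q≈ , ax _ _) = ≈ₑ-trans Γ≈ (upd-cong i (≈-sym Q≈))

⟦var⟧⁺ : ∀ {n} {i : Fin n} {Γ Q} → Γ ≈ₑ (𝟘ₑ [ i ]≔ Q) → ⟦ var i ⟧ Γ Q
⟦var⟧⁺ Γ≈ = _ , _ , Γ≈ , ≈-refl , ax _ _

↭-[]⁻ : ∀ {ys} → Permutation _≈²_ [] ys → ys ≡ []
↭-[]⁻ (Perm.refl [])              = refl
↭-[]⁻ (trans p q) rewrite ↭-[]⁻ p = ↭-[]⁻ q

↭-[x]⁻ : ∀ {x ys} → Permutation _≈²_ [ x ] ys → ∃[ y ] (ys ≡ [ y ] × x ≈² y)
↭-[x]⁻ (Perm.refl (e ∷ [])) = _ , refl , e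
↭-[x]⁻ (prep e p) with ↭-[]⁻ p
... | refl = _ , refl , e
↭-[x]⁻ (trans p q) with ↭-[x]⁻ p
... | _ , refl , e with ↭-[x]⁻ q
... | z , refl , e′ = z , refl , ≈²-trans e e′

⟦·⟧⁻ : ∀ {n} {t u : Term n} {Γ Q} → ⟦ t · u ⟧ Γ Q →
       ∃[ Γ₁ ] ∃[ Γ₂ ] ∃[ P ] (Γ ≈ₑ (Γ₁ ⊎ₑ Γ₂) × ⟦ t ⟧ Γ₁ (mset [ (P , Q) ]) × ⟦ u ⟧ Γ₂ P)
⟦·⟧⁻ (_ , _ , Γ≈ , Q≈ , app {Γ = Γ₁} {Δ = Γ₂} {P = P} dt du P≈) =
  Γ₁ , Γ₂ , P , Γ≈ , (_ , _ , ≈ₑ-refl , mset≈ (Perm.refl (pair≈ ≈-refl Q≈ ∷ [])) , dt)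
                   , (_ , _ , ≈ₑ-refl , P≈ , du)

⟦·⟧⁺ : ∀ {n} {t u : Term n} {Γ Γ₁ Γ₂ P Q} → Γ ≈ₑ (Γ₁ ⊎ₑ Γ₂) →
       ⟦ t ⟧ Γ₁ (mset [ (P , Q) ]) → ⟦ u ⟧ Γ₂ P → ⟦ t · u ⟧ Γ Q
⟦·⟧⁺ Γ≈ (Δ₁ , _ , Γ₁≈ , mset≈ p , dt) (Δ₂ , _ , Γ₂≈ , P≈ , du) with ↭-[x]⁻ p
... | _ , refl , pair≈ P≈′ Q≈ =
  Δ₁ ⊎ₑ Δ₂ , _ , ≈ₑ-trans Γ≈ (⊎ₑ-cong Γ₁≈ Γ₂≈) , Q≈ , app dt du (≈-trans (≈-sym P≈′) P≈)

⟦_⟧ˡ : ∀ {n} → Term (suc n) → Env n → List (Pos × Pos) → Set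
⟦ t ⟧ˡ Γ []             = Γ ≈ₑ 𝟘ₑ
⟦ t ⟧ˡ Γ ((P , Q) ∷ ps) =
  ∃[ Γ₁ ] ∃[ Γ₂ ] (Γ ≈ₑ (Γ₁ ⊎ₑ Γ₂) × ⟦ t ⟧ (P ∷ Γ₁) Q × ⟦ t ⟧ˡ Γ₂ ps)

⟦⟧ˡ-respₑ : ∀ {n} {t : Term (suc n)} {Γ Γ′} ps → Γ ≈ₑ Γ′ → ⟦ t ⟧ˡ Γ ps → ⟦ t ⟧ˡ Γ′ ps
⟦⟧ˡ-respₑ []      Γ≈ l                        = ≈ₑ-trans (≈ₑ-sym Γ≈) l
⟦⟧ˡ-respₑ (_ ∷ _) Γ≈ (Γ₁ , Γ₂ , Γ≈′ , d , l) = Γ₁ , Γ₂ , ≈ₑ-trans (≈ₑ-sym Γ≈) Γ≈′ , d , l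

⟦⟧ˡ-resp-≋ : ∀ {n} {t : Term (suc n)} {Γ ps qs} →
             ListPw.Pointwise _≈²_ ps qs → ⟦ t ⟧ˡ Γ ps → ⟦ t ⟧ˡ Γ qs
⟦⟧ˡ-resp-≋ []                 l                      = l
⟦⟧ˡ-resp-≋ (pair≈ p q ∷ ps≋) (Γ₁ , Γ₂ , Γ≈ , d , l) =
  Γ₁ , Γ₂ , Γ≈ , ⟦⟧-resp (p ∷ ≈ₑ-refl) q d , ⟦⟧ˡ-resp-≋ ps≋ l

⟦⟧ˡ-resp-↭ : ∀ {n} {t : Term (suc n)} {Γ ps qs} →
             Permutation _≈²_ ps qs → ⟦ t ⟧ˡ Γ ps → ⟦ t ⟧ˡ Γ qs
⟦⟧ˡ-resp-↭ (Perm.refl ps≋) l = ⟦⟧ˡ-resp-≋ ps≋ l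
⟦⟧ˡ-resp-↭ (prep (pair≈ p q) ps↭) (Γ₁ , Γ₂ , Γ≈ , d , l) =
  Γ₁ , Γ₂ , Γ≈ , ⟦⟧-resp (p ∷ ≈ₑ-refl) q d , ⟦⟧ˡ-resp-↭ ps↭ l
⟦⟧ˡ-resp-↭ (swap (pair≈ p q) (pair≈ p′ q′) ps↭) (Γ₁ , _ , Γ≈ , d , (Γ₃ , Γ₄ , Γ≈′ , d′ , l)) =
  Γ₃ , Γ₁ ⊎ₑ Γ₄ , ≈ₑ-trans Γ≈ (≈ₑ-trans (⊎ₑ-cong ≈ₑ-refl Γ≈′) (⊎ₑ-leftSwap Γ₁ Γ₃ Γ₄)) ,
  ⟦⟧-resp (p′ ∷ ≈ₑ-refl) q′ d′ , (Γ₁ , Γ₄ , ≈ₑ-refl , ⟦⟧-resp (p ∷ ≈ₑ-refl) q d , ⟦⟧ˡ-resp-↭ ps↭ l)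
⟦⟧ˡ-resp-↭ (trans p q) l = ⟦⟧ˡ-resp-↭ q (⟦⟧ˡ-resp-↭ p l)

⊢λ⇒⟦⟧ˡ : ∀ {n} {t : Term (suc n)} {Γ ps} → Γ ⊢λ t ∶ ps → ⟦ t ⟧ˡ Γ ps
⊢λ⇒⟦⟧ˡ nil         = ≈ₑ-refl
⊢λ⇒⟦⟧ˡ (cons d ds) = _ , _ , ≈ₑ-refl , (_ , _ , ≈ₑ-refl , ≈-refl , d) , ⊢λ⇒⟦⟧ˡ ds

⟦⟧ˡ⇒⊢λ : ∀ {n} {t : Term (suc n)} {Γ} ps → ⟦ t ⟧ˡ Γ ps →
         ∃[ Γ′ ] ∃[ ps′ ] (Γ ≈ₑ Γ′ × Permutation _≈²_ ps ps′ × Γ′ ⊢λ t ∶ ps′)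
⟦⟧ˡ⇒⊢λ []      Γ≈ = 𝟘ₑ , [] , Γ≈ , Perm.refl [] , nil
⟦⟧ˡ⇒⊢λ (_ ∷ ps) (_ , _ , Γ≈ , (_ ∷ Γ₁′ , _ , P≈ ∷ Γ₁≈ , Q≈ , d) , l) with ⟦⟧ˡ⇒⊢λ ps l
... | Γ₂′ , _ , Γ₂≈ , ps↭ , ds =
  Γ₁′ ⊎ₑ Γ₂′ , _ , ≈ₑ-trans Γ≈ (⊎ₑ-cong Γ₁≈ Γ₂≈) , prep (pair≈ P≈ Q≈) ps↭ , cons d ds

⟦ƛ⟧⁻ : ∀ {n} {t : Term (suc n)} {Γ ps} → ⟦ ƛ t ⟧ Γ (mset ps) → ⟦ t ⟧ˡ Γ ps
⟦ƛ⟧⁻ (_ , _ , Γ≈ , mset≈ p , lam d) = ⟦⟧ˡ-resp-↭ (↭-sym p) (⟦⟧ˡ-respₑ _ (≈ₑ-sym Γ≈) (⊢λ⇒⟦⟧ˡ d))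

⟦ƛ⟧⁺ : ∀ {n} {t : Term (suc n)} {Γ ps} → ⟦ t ⟧ˡ Γ ps → ⟦ ƛ t ⟧ Γ (mset ps)
⟦ƛ⟧⁺ {ps = ps} l with ⟦⟧ˡ⇒⊢λ ps l
... | Γ′ , ps′ , Γ≈ , ps↭ , d = Γ′ , mset ps′ , Γ≈ , mset≈ ps↭ , lam d

⟦ƛ⟧¹⁻ : ∀ {n} {t : Term (suc n)} {Γ P Q} → ⟦ ƛ t ⟧ Γ (mset [ (P , Q) ]) → ⟦ t ⟧ (P ∷ Γ) Q
⟦ƛ⟧¹⁻ x with ⟦ƛ⟧⁻ x
... | _ , _ , Γ≈ , d , Γ₂≈𝟘 = ⟦⟧-respₑ (≈-refl ∷ ≈ₑ-sym (≈ₑ-⊎ₑ-𝟘ʳ Γ≈ Γ₂≈𝟘)) d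

⟦ƛ⟧¹⁺ : ∀ {n} {t : Term (suc n)} {Γ P Q} → ⟦ t ⟧ (P ∷ Γ) Q → ⟦ ƛ t ⟧ Γ (mset [ (P , Q) ])
⟦ƛ⟧¹⁺ {Γ = Γ} d = ⟦ƛ⟧⁺ (Γ , 𝟘ₑ , ≈ₑ-sym (⊎ₑ-identityʳ Γ) , d , ≈ₑ-refl)

_≲_ : ∀ {n} → Term n → Term n → Set
t ≲ u = ∀ {Γ Q} → ⟦ t ⟧ Γ Q → ⟦ u ⟧ Γ Q

⟦⟧ˡ-mono : ∀ {n} {t t′ : Term (suc n)} → t ≲ t′ → ∀ {Γ} ps → ⟦ t ⟧ˡ Γ ps → ⟦ t′ ⟧ˡ Γ ps
⟦⟧ˡ-mono t≲t′ []       l                      = l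
⟦⟧ˡ-mono t≲t′ (_ ∷ ps) (Γ₁ , Γ₂ , Γ≈ , d , l) = Γ₁ , Γ₂ , Γ≈ , t≲t′ d , ⟦⟧ˡ-mono t≲t′ ps l

ƛ-mono : ∀ {n} {t t′ : Term (suc n)} → t ≲ t′ → (ƛ t) ≲ (ƛ t′)
ƛ-mono t≲t′ {Q = mset ps} x = ⟦ƛ⟧⁺ (⟦⟧ˡ-mono t≲t′ ps (⟦ƛ⟧⁻ x))

·-monoˡ : ∀ {n} {t t′ u : Term n} → t ≲ t′ → (t · u) ≲ (t′ · u)
·-monoˡ t≲t′ x with ⟦·⟧⁻ x
... | _ , _ , _ , Γ≈ , dt , du = ⟦·⟧⁺ Γ≈ (t≲t′ dt) du

·-monoʳ : ∀ {n} {t u u′ : Term n} → u ≲ u′ → (t · u) ≲ (t · u′)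
·-monoʳ u≲u′ x with ⟦·⟧⁻ x
... | _ , _ , _ , Γ≈ , dt , du = ⟦·⟧⁺ Γ≈ dt (u≲u′ du)

-- Renaming and weakening

pushₑ : ∀ {m n} → (Fin m → Fin n) → Env m → Env n
pushₑ ρ []      = 𝟘ₑ
pushₑ ρ (P ∷ Δ) = (𝟘ₑ [ ρ zero ]≔ P) ⊎ₑ pushₑ (ρ ∘ suc) Δ

pushₑ-cong : ∀ {m n} (ρ : Fin m → Fin n) {Δ Δ′} → Δ ≈ₑ Δ′ → pushₑ ρ Δ ≈ₑ pushₑ ρ Δ′
pushₑ-cong ρ []       = ≈ₑ-refl
pushₑ-cong ρ (p ∷ ps) = ⊎ₑ-cong (upd-cong (ρ zero) p) (pushₑ-cong (ρ ∘ suc) ps)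

pushₑ-𝟘 : ∀ {m n} (ρ : Fin m → Fin n) → pushₑ ρ 𝟘ₑ ≈ₑ 𝟘ₑ
pushₑ-𝟘 {zero}  ρ = ≈ₑ-refl
pushₑ-𝟘 {suc m} ρ =
  ≈ₑ-trans (⊎ₑ-cong (upd-𝟘 (ρ zero)) (pushₑ-𝟘 (ρ ∘ suc))) (⊎ₑ-identityˡ 𝟘ₑ)

pushₑ-⊎ₑ : ∀ {m n} (ρ : Fin m → Fin n) (Δ₁ Δ₂ : Env m) →
           pushₑ ρ (Δ₁ ⊎ₑ Δ₂) ≈ₑ (pushₑ ρ Δ₁ ⊎ₑ pushₑ ρ Δ₂)
pushₑ-⊎ₑ ρ []        []        = ≈ₑ-sym (⊎ₑ-identityˡ 𝟘ₑ)
pushₑ-⊎ₑ ρ (P ∷ Δ₁) (P′ ∷ Δ₂) =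
  ≈ₑ-trans (⊎ₑ-cong (upd-⊎ₚ (ρ zero) P P′) (pushₑ-⊎ₑ (ρ ∘ suc) Δ₁ Δ₂)) (⊎ₑ-interchange _ _ _ _)

pushₑ-upd : ∀ {m n} (ρ : Fin m → Fin n) (i : Fin m) Q → pushₑ ρ (𝟘ₑ [ i ]≔ Q) ≈ₑ (𝟘ₑ [ ρ i ]≔ Q)
pushₑ-upd ρ zero    Q = ≈ₑ-trans (⊎ₑ-cong ≈ₑ-refl (pushₑ-𝟘 (ρ ∘ suc))) (⊎ₑ-identityʳ _)
pushₑ-upd ρ (suc i) Q =
  ≈ₑ-trans (⊎ₑ-cong (upd-𝟘 (ρ zero)) (pushₑ-upd (ρ ∘ suc) i Q)) (⊎ₑ-identityˡ _)

pushₑ-suc : ∀ {m n} (ρ : Fin m → Fin n) (Δ : Env m) → pushₑ (suc ∘ ρ) Δ ≈ₑ (𝟘 ∷ pushₑ ρ Δ)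
pushₑ-suc ρ []      = ≈ₑ-refl
pushₑ-suc ρ (P ∷ Δ) = ⊎ₑ-cong ≈ₑ-refl (pushₑ-suc (ρ ∘ suc) Δ)

pushₑ-id : ∀ {m} (Δ : Env m) → pushₑ id Δ ≈ₑ Δ
pushₑ-id []      = ≈ₑ-refl
pushₑ-id (P ∷ Δ) = ≈ₑ-trans (⊎ₑ-cong ≈ₑ-refl (pushₑ-suc id Δ))
                            (⊎ₚ-identityʳ P ∷ ≈ₑ-trans (⊎ₑ-identityˡ _) (pushₑ-id Δ))

pushₑ-ext : ∀ {m n} (ρ : Fin m → Fin n) P (Δ : Env m) → pushₑ (ext ρ) (P ∷ Δ) ≈ₑ (P ∷ pushₑ ρ Δ)
pushₑ-ext ρ P Δ = ≈ₑ-trans (⊎ₑ-cong ≈ₑ-refl (pushₑ-suc ρ Δ)) (⊎ₚ-identityʳ P ∷ ⊎ₑ-identityˡ _)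

mutual
  ⟦rename⟧⁻ : ∀ {m n} (ρ : Fin m → Fin n) (t : Term m) {Γ Q} →
              ⟦ rename ρ t ⟧ Γ Q → ∃[ Δ ] (Γ ≈ₑ pushₑ ρ Δ × ⟦ t ⟧ Δ Q)
  ⟦rename⟧⁻ ρ (var i) {Q = Q} x =
    𝟘ₑ [ i ]≔ Q , ≈ₑ-trans (⟦var⟧⁻ x) (≈ₑ-sym (pushₑ-upd ρ i Q)) , ⟦var⟧⁺ ≈ₑ-refl
  ⟦rename⟧⁻ ρ (t · u) x with ⟦·⟧⁻ x
  ... | _ , _ , _ , Γ≈ , dt , du with ⟦rename⟧⁻ ρ t dt | ⟦rename⟧⁻ ρ u du
  ... | Δ₁ , Γ₁≈ , dt′ | Δ₂ , Γ₂≈ , du′ =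
    Δ₁ ⊎ₑ Δ₂ , ≈ₑ-trans Γ≈ (≈ₑ-trans (⊎ₑ-cong Γ₁≈ Γ₂≈) (≈ₑ-sym (pushₑ-⊎ₑ ρ Δ₁ Δ₂))) ,
    ⟦·⟧⁺ ≈ₑ-refl dt′ du′
  ⟦rename⟧⁻ ρ (ƛ t) {Q = mset ps} x with ⟦rename⟧ˡ⁻ ρ t ps (⟦ƛ⟧⁻ x)
  ... | Δ , Γ≈ , l = Δ , Γ≈ , ⟦ƛ⟧⁺ l

  ⟦rename⟧ˡ⁻ : ∀ {m n} (ρ : Fin m → Fin n) (t : Term (suc m)) ps {Γ} →
               ⟦ rename (ext ρ) t ⟧ˡ Γ ps → ∃[ Δ ] (Γ ≈ₑ pushₑ ρ Δ × ⟦ t ⟧ˡ Δ ps)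
  ⟦rename⟧ˡ⁻ ρ t []       Γ≈𝟘 = 𝟘ₑ , ≈ₑ-trans Γ≈𝟘 (≈ₑ-sym (pushₑ-𝟘 ρ)) , ≈ₑ-refl
  ⟦rename⟧ˡ⁻ ρ t (_ ∷ ps) (_ , _ , Γ≈ , d , l) with ⟦rename⟧⁻ (ext ρ) t d
  ... | P′ ∷ Δ₁ , Γ₁≈ , d′ with ≈ₑ-trans Γ₁≈ (pushₑ-ext ρ P′ Δ₁) | ⟦rename⟧ˡ⁻ ρ t ps l
  ... | P≈ ∷ Γ₁≈′ | Δ₂ , Γ₂≈ , l′ =
    Δ₁ ⊎ₑ Δ₂ , ≈ₑ-trans Γ≈ (≈ₑ-trans (⊎ₑ-cong Γ₁≈′ Γ₂≈) (≈ₑ-sym (pushₑ-⊎ₑ ρ Δ₁ Δ₂))) ,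
    (Δ₁ , Δ₂ , ≈ₑ-refl , ⟦⟧-respₑ (≈-sym P≈ ∷ ≈ₑ-refl) d′ , l′)

mutual
  ⟦rename⟧⁺ : ∀ {m n} (ρ : Fin m → Fin n) (t : Term m) {Δ Q} →
              ⟦ t ⟧ Δ Q → ⟦ rename ρ t ⟧ (pushₑ ρ Δ) Q
  ⟦rename⟧⁺ ρ (var i) {Q = Q} x = ⟦var⟧⁺ (≈ₑ-trans (pushₑ-cong ρ (⟦var⟧⁻ x)) (pushₑ-upd ρ i Q))
  ⟦rename⟧⁺ ρ (t · u) x with ⟦·⟧⁻ x
  ... | Δ₁ , Δ₂ , _ , Δ≈ , dt , du =
    ⟦·⟧⁺ (≈ₑ-trans (pushₑ-cong ρ Δ≈) (pushₑ-⊎ₑ ρ Δ₁ Δ₂)) (⟦rename⟧⁺ ρ t dt) (⟦rename⟧⁺ ρ u du)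
  ⟦rename⟧⁺ ρ (ƛ t) {Q = mset ps} x = ⟦ƛ⟧⁺ (⟦rename⟧ˡ⁺ ρ t ps (⟦ƛ⟧⁻ x))

  ⟦rename⟧ˡ⁺ : ∀ {m n} (ρ : Fin m → Fin n) (t : Term (suc m)) ps {Δ} →
               ⟦ t ⟧ˡ Δ ps → ⟦ rename (ext ρ) t ⟧ˡ (pushₑ ρ Δ) ps
  ⟦rename⟧ˡ⁺ ρ t []            Δ≈𝟘 = ≈ₑ-trans (pushₑ-cong ρ Δ≈𝟘) (pushₑ-𝟘 ρ)
  ⟦rename⟧ˡ⁺ ρ t ((P , _) ∷ ps) (Δ₁ , Δ₂ , Δ≈ , d , l) =
    pushₑ ρ Δ₁ , pushₑ ρ Δ₂ , ≈ₑ-trans (pushₑ-cong ρ Δ≈) (pushₑ-⊎ₑ ρ Δ₁ Δ₂) ,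
    ⟦⟧-respₑ (pushₑ-ext ρ P Δ₁) (⟦rename⟧⁺ (ext ρ) t d) , ⟦rename⟧ˡ⁺ ρ t ps l

⟦weaken⟧⁻ : ∀ {n} (s : Term n) {P Γ Q} → ⟦ weaken s ⟧ (P ∷ Γ) Q → P ≈ 𝟘 × ⟦ s ⟧ Γ Q
⟦weaken⟧⁻ s x with ⟦rename⟧⁻ suc s x
... | Δ , Γ≈ , d with ≈ₑ-trans Γ≈ (pushₑ-suc id Δ)
... | P≈𝟘 ∷ Γ≈′ = P≈𝟘 , ⟦⟧-respₑ (≈ₑ-sym (≈ₑ-trans Γ≈′ (pushₑ-id Δ))) d

⟦weaken⟧⁺ : ∀ {n} (s : Term n) {P Γ Q} → P ≈ 𝟘 → ⟦ s ⟧ Γ Q → ⟦ weaken s ⟧ (P ∷ Γ) Q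
⟦weaken⟧⁺ s {Γ = Γ} P≈𝟘 d =
  ⟦⟧-respₑ (≈ₑ-trans (pushₑ-suc id Γ) (≈-sym P≈𝟘 ∷ pushₑ-id Γ)) (⟦rename⟧⁺ suc s d)

-- Values are duplicable and erasable

⟦⟧ˡ-++⁻ : ∀ {n} {t : Term (suc n)} ps qs {Γ} → ⟦ t ⟧ˡ Γ (ps ++ qs) →
          ∃[ Γ₁ ] ∃[ Γ₂ ] (Γ ≈ₑ (Γ₁ ⊎ₑ Γ₂) × ⟦ t ⟧ˡ Γ₁ ps × ⟦ t ⟧ˡ Γ₂ qs)
⟦⟧ˡ-++⁻ []       qs {Γ} l = 𝟘ₑ , Γ , ≈ₑ-sym (⊎ₑ-identityˡ Γ) , ≈ₑ-refl , l
⟦⟧ˡ-++⁻ (_ ∷ ps) qs (Γ₁ , Γ₂ , Γ≈ , d , l) with ⟦⟧ˡ-++⁻ ps qs l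
... | Γ₃ , Γ₄ , Γ₂≈ , l₁ , l₂ =
  Γ₁ ⊎ₑ Γ₃ , Γ₄ , ≈ₑ-trans Γ≈ (≈ₑ-trans (⊎ₑ-cong ≈ₑ-refl Γ₂≈) (≈ₑ-sym (⊎ₑ-assoc Γ₁ Γ₃ Γ₄))) ,
  (Γ₁ , Γ₃ , ≈ₑ-refl , d , l₁) , l₂

⟦⟧ˡ-++⁺ : ∀ {n} {t : Term (suc n)} ps qs {Γ Γ₁ Γ₂} → Γ ≈ₑ (Γ₁ ⊎ₑ Γ₂) →
          ⟦ t ⟧ˡ Γ₁ ps → ⟦ t ⟧ˡ Γ₂ qs → ⟦ t ⟧ˡ Γ (ps ++ qs)
⟦⟧ˡ-++⁺ []       qs Γ≈ Γ₁≈𝟘 l₂ = ⟦⟧ˡ-respₑ qs (≈ₑ-sym (≈ₑ-⊎ₑ-𝟘ˡ Γ≈ Γ₁≈𝟘)) l₂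
⟦⟧ˡ-++⁺ (_ ∷ ps) qs {Γ₂ = Γ₂} Γ≈ (Γ₃ , Γ₄ , Γ₁≈ , d , l₁) l₂ =
  Γ₃ , Γ₄ ⊎ₑ Γ₂ , ≈ₑ-trans Γ≈ (≈ₑ-trans (⊎ₑ-cong Γ₁≈ ≈ₑ-refl) (⊎ₑ-assoc Γ₃ Γ₄ Γ₂)) , d ,
  ⟦⟧ˡ-++⁺ ps qs ≈ₑ-refl l₁ l₂

value-𝟘⁻ : ∀ {n} {v : Term n} {Γ} → Value v → ⟦ v ⟧ Γ 𝟘 → Γ ≈ₑ 𝟘ₑ
value-𝟘⁻ (var-val i) x = ≈ₑ-trans (⟦var⟧⁻ x) (upd-𝟘 i)
value-𝟘⁻ (lam-val t) x = ⟦ƛ⟧⁻ x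

value-𝟘⁺ : ∀ {n} {v : Term n} {Γ} → Value v → Γ ≈ₑ 𝟘ₑ → ⟦ v ⟧ Γ 𝟘
value-𝟘⁺ (var-val i) Γ≈𝟘 = ⟦var⟧⁺ (≈ₑ-trans Γ≈𝟘 (≈ₑ-sym (upd-𝟘 i)))
value-𝟘⁺ (lam-val t) Γ≈𝟘 = ⟦ƛ⟧⁺ Γ≈𝟘

value-⊎ₚ⁻ : ∀ {n} {v : Term n} {Γ} → Value v → ∀ P P′ → ⟦ v ⟧ Γ (P ⊎ₚ P′) →
            ∃[ Γ₁ ] ∃[ Γ₂ ] (Γ ≈ₑ (Γ₁ ⊎ₑ Γ₂) × ⟦ v ⟧ Γ₁ P × ⟦ v ⟧ Γ₂ P′)
value-⊎ₚ⁻ (var-val i) P P′ x =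
  _ , _ , ≈ₑ-trans (⟦var⟧⁻ x) (upd-⊎ₚ i P P′) , ⟦var⟧⁺ ≈ₑ-refl , ⟦var⟧⁺ ≈ₑ-refl
value-⊎ₚ⁻ (lam-val t) (mset ps) (mset qs) x with ⟦⟧ˡ-++⁻ ps qs (⟦ƛ⟧⁻ x)
... | Γ₁ , Γ₂ , Γ≈ , l₁ , l₂ = Γ₁ , Γ₂ , Γ≈ , ⟦ƛ⟧⁺ l₁ , ⟦ƛ⟧⁺ l₂

value-⊎ₚ⁺ : ∀ {n} {v : Term n} {Γ Γ₁ Γ₂} → Value v → ∀ P P′ → Γ ≈ₑ (Γ₁ ⊎ₑ Γ₂) →
            ⟦ v ⟧ Γ₁ P → ⟦ v ⟧ Γ₂ P′ → ⟦ v ⟧ Γ (P ⊎ₚ P′)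
value-⊎ₚ⁺ (var-val i) P P′ Γ≈ x₁ x₂ =
  ⟦var⟧⁺ (≈ₑ-trans Γ≈ (≈ₑ-trans (⊎ₑ-cong (⟦var⟧⁻ x₁) (⟦var⟧⁻ x₂)) (≈ₑ-sym (upd-⊎ₚ i P P′))))
value-⊎ₚ⁺ (lam-val t) (mset ps) (mset qs) Γ≈ x₁ x₂ =
  ⟦ƛ⟧⁺ (⟦⟧ˡ-++⁺ ps qs Γ≈ (⟦ƛ⟧⁻ x₁) (⟦ƛ⟧⁻ x₂))

Value-weaken : ∀ {n} {v : Term n} → Value v → Value (weaken v)
Value-weaken (var-val i) = var-val (suc i)
Value-weaken (lam-val t) = lam-val _

-- Substitution of values

⟦_⟧ˢ : ∀ {m n} → (Fin m → Term n) → Env n → Env m → Set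
⟦ σ ⟧ˢ Γ []      = Γ ≈ₑ 𝟘ₑ
⟦ σ ⟧ˢ Γ (D ∷ Δ) = ∃[ Γ₁ ] ∃[ Γ₂ ] (Γ ≈ₑ (Γ₁ ⊎ₑ Γ₂) × ⟦ σ zero ⟧ Γ₁ D × ⟦ σ ∘ suc ⟧ˢ Γ₂ Δ)

Values : ∀ {m n} → (Fin m → Term n) → Set
Values σ = ∀ i → Value (σ i)

Values-exts : ∀ {m n} {σ : Fin m → Term n} → Values σ → Values (exts σ)
Values-exts vs zero    = var-val zero
Values-exts vs (suc i) = Value-weaken (vs i)

⟦⟧ˢ-respˡ : ∀ {m n} {σ : Fin m → Term n} Δ {Γ Γ′} → Γ ≈ₑ Γ′ → ⟦ σ ⟧ˢ Γ Δ → ⟦ σ ⟧ˢ Γ′ Δ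
⟦⟧ˢ-respˡ []      Γ≈ Γ≈𝟘                    = ≈ₑ-trans (≈ₑ-sym Γ≈) Γ≈𝟘
⟦⟧ˢ-respˡ (_ ∷ Δ) Γ≈ (Γ₁ , Γ₂ , Γ≈′ , d , s) = Γ₁ , Γ₂ , ≈ₑ-trans (≈ₑ-sym Γ≈) Γ≈′ , d , s

⟦⟧ˢ-respʳ : ∀ {m n} {σ : Fin m → Term n} {Γ Δ Δ′} → Δ ≈ₑ Δ′ → ⟦ σ ⟧ˢ Γ Δ → ⟦ σ ⟧ˢ Γ Δ′
⟦⟧ˢ-respʳ []         s                      = s
⟦⟧ˢ-respʳ (D≈ ∷ Δ≈) (Γ₁ , Γ₂ , Γ≈ , d , s) = Γ₁ , Γ₂ , Γ≈ , ⟦⟧-resp ≈ₑ-refl D≈ d , ⟦⟧ˢ-respʳ Δ≈ s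

⟦⟧ˢ-𝟘⁻ : ∀ {m n} {σ : Fin m → Term n} {Γ} → Values σ → ⟦ σ ⟧ˢ Γ 𝟘ₑ → Γ ≈ₑ 𝟘ₑ
⟦⟧ˢ-𝟘⁻ {zero}  vs Γ≈𝟘                    = Γ≈𝟘
⟦⟧ˢ-𝟘⁻ {suc m} vs (_ , _ , Γ≈ , d , s) =
  ≈ₑ-trans (≈ₑ-⊎ₑ-𝟘ʳ Γ≈ (⟦⟧ˢ-𝟘⁻ (vs ∘ suc) s)) (value-𝟘⁻ (vs zero) d)

⟦⟧ˢ-𝟘⁺ : ∀ {m n} {σ : Fin m → Term n} {Γ} → Values σ → Γ ≈ₑ 𝟘ₑ → ⟦ σ ⟧ˢ Γ 𝟘ₑ
⟦⟧ˢ-𝟘⁺ {zero}        vs Γ≈𝟘 = Γ≈𝟘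
⟦⟧ˢ-𝟘⁺ {suc m} {Γ = Γ} vs Γ≈𝟘 =
  𝟘ₑ , Γ , ≈ₑ-sym (⊎ₑ-identityˡ Γ) , value-𝟘⁺ (vs zero) ≈ₑ-refl , ⟦⟧ˢ-𝟘⁺ (vs ∘ suc) Γ≈𝟘

⟦⟧ˢ-⊎ₑ⁻ : ∀ {m n} {σ : Fin m → Term n} {Γ} → Values σ → ∀ Δ₁ Δ₂ → ⟦ σ ⟧ˢ Γ (Δ₁ ⊎ₑ Δ₂) →
          ∃[ Γ₁ ] ∃[ Γ₂ ] (Γ ≈ₑ (Γ₁ ⊎ₑ Γ₂) × ⟦ σ ⟧ˢ Γ₁ Δ₁ × ⟦ σ ⟧ˢ Γ₂ Δ₂)
⟦⟧ˢ-⊎ₑ⁻ vs [] [] Γ≈𝟘 = 𝟘ₑ , 𝟘ₑ , ≈ₑ-trans Γ≈𝟘 (≈ₑ-sym (⊎ₑ-identityˡ 𝟘ₑ)) , ≈ₑ-refl , ≈ₑ-refl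
⟦⟧ˢ-⊎ₑ⁻ vs (D₁ ∷ Δ₁) (D₂ ∷ Δ₂) (_ , _ , Γ≈ , d , s)
  with value-⊎ₚ⁻ (vs zero) D₁ D₂ d | ⟦⟧ˢ-⊎ₑ⁻ (vs ∘ suc) Δ₁ Δ₂ s
... | Γ₁ , Γ₂ , Γ₁₂≈ , d₁ , d₂ | Γ₃ , Γ₄ , Γ₃₄≈ , s₁ , s₂ =
  Γ₁ ⊎ₑ Γ₃ , Γ₂ ⊎ₑ Γ₄ , ≈ₑ-trans Γ≈ (≈ₑ-trans (⊎ₑ-cong Γ₁₂≈ Γ₃₄≈) (⊎ₑ-interchange Γ₁ Γ₂ Γ₃ Γ₄)) ,
  (Γ₁ , Γ₃ , ≈ₑ-refl , d₁ , s₁) , (Γ₂ , Γ₄ , ≈ₑ-refl , d₂ , s₂)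

⟦⟧ˢ-⊎ₑ⁺ : ∀ {m n} {σ : Fin m → Term n} {Γ Γ₁ Γ₂} → Values σ → ∀ Δ₁ Δ₂ → Γ ≈ₑ (Γ₁ ⊎ₑ Γ₂) →
          ⟦ σ ⟧ˢ Γ₁ Δ₁ → ⟦ σ ⟧ˢ Γ₂ Δ₂ → ⟦ σ ⟧ˢ Γ (Δ₁ ⊎ₑ Δ₂)
⟦⟧ˢ-⊎ₑ⁺ vs [] [] Γ≈ s₁ s₂ = ≈ₑ-trans Γ≈ (≈ₑ-trans (⊎ₑ-cong s₁ s₂) (⊎ₑ-identityˡ 𝟘ₑ))
⟦⟧ˢ-⊎ₑ⁺ vs (D₁ ∷ Δ₁) (D₂ ∷ Δ₂) Γ≈ (Γ₁ , Γ₃ , Γ₁≈ , d₁ , s₁) (Γ₂ , Γ₄ , Γ₂≈ , d₂ , s₂) =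
  Γ₁ ⊎ₑ Γ₂ , Γ₃ ⊎ₑ Γ₄ , ≈ₑ-trans Γ≈ (≈ₑ-trans (⊎ₑ-cong Γ₁≈ Γ₂≈) (⊎ₑ-interchange Γ₁ Γ₃ Γ₂ Γ₄)) ,
  value-⊎ₚ⁺ (vs zero) D₁ D₂ ≈ₑ-refl d₁ d₂ , ⟦⟧ˢ-⊎ₑ⁺ (vs ∘ suc) Δ₁ Δ₂ ≈ₑ-refl s₁ s₂

⟦⟧ˢ-upd⁻ : ∀ {m n} {σ : Fin m → Term n} {Γ Q} → Values σ → ∀ i →
           ⟦ σ ⟧ˢ Γ (𝟘ₑ [ i ]≔ Q) → ⟦ σ i ⟧ Γ Q
⟦⟧ˢ-upd⁻ vs zero (_ , _ , Γ≈ , d , s) =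
  ⟦⟧-respₑ (≈ₑ-sym (≈ₑ-⊎ₑ-𝟘ʳ Γ≈ (⟦⟧ˢ-𝟘⁻ (vs ∘ suc) s))) d
⟦⟧ˢ-upd⁻ vs (suc i) (_ , _ , Γ≈ , d , s) =
  ⟦⟧-respₑ (≈ₑ-sym (≈ₑ-⊎ₑ-𝟘ˡ Γ≈ (value-𝟘⁻ (vs zero) d))) (⟦⟧ˢ-upd⁻ (vs ∘ suc) i s)

⟦⟧ˢ-upd⁺ : ∀ {m n} {σ : Fin m → Term n} {Γ Q} → Values σ → ∀ i →
           ⟦ σ i ⟧ Γ Q → ⟦ σ ⟧ˢ Γ (𝟘ₑ [ i ]≔ Q)
⟦⟧ˢ-upd⁺ {Γ = Γ} vs zero d =
  Γ , 𝟘ₑ , ≈ₑ-sym (⊎ₑ-identityʳ Γ) , d , ⟦⟧ˢ-𝟘⁺ (vs ∘ suc) ≈ₑ-refl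
⟦⟧ˢ-upd⁺ {Γ = Γ} vs (suc i) d =
  𝟘ₑ , Γ , ≈ₑ-sym (⊎ₑ-identityˡ Γ) , value-𝟘⁺ (vs zero) ≈ₑ-refl , ⟦⟧ˢ-upd⁺ (vs ∘ suc) i d

⟦⟧ˢ-weaken⁻ : ∀ {m n} {σ : Fin m → Term n} Δ {P Γ} →
              ⟦ weaken ∘ σ ⟧ˢ (P ∷ Γ) Δ → P ≈ 𝟘 × ⟦ σ ⟧ˢ Γ Δ
⟦⟧ˢ-weaken⁻ []      (P≈𝟘 ∷ Γ≈𝟘) = P≈𝟘 , Γ≈𝟘
⟦⟧ˢ-weaken⁻ {σ = σ} (_ ∷ Δ) (_ ∷ Γ₁ , _ ∷ Γ₂ , P≈ ∷ Γ≈ , d , s)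
  with ⟦weaken⟧⁻ (σ zero) d | ⟦⟧ˢ-weaken⁻ Δ s
... | P₁≈𝟘 , d′ | P₂≈𝟘 , s′ = ≈-trans P≈ (⊎ₚ-cong P₁≈𝟘 P₂≈𝟘) , (Γ₁ , Γ₂ , Γ≈ , d′ , s′)

⟦⟧ˢ-weaken⁺ : ∀ {m n} {σ : Fin m → Term n} Δ {P Γ} → P ≈ 𝟘 →
              ⟦ σ ⟧ˢ Γ Δ → ⟦ weaken ∘ σ ⟧ˢ (P ∷ Γ) Δ
⟦⟧ˢ-weaken⁺ []      P≈𝟘 Γ≈𝟘 = P≈𝟘 ∷ Γ≈𝟘
⟦⟧ˢ-weaken⁺ {σ = σ} (_ ∷ Δ) {P} P≈𝟘 (Γ₁ , Γ₂ , Γ≈ , d , s) =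
  P ∷ Γ₁ , 𝟘 ∷ Γ₂ , ≈-sym (⊎ₚ-identityʳ P) ∷ Γ≈ , ⟦weaken⟧⁺ (σ zero) P≈𝟘 d , ⟦⟧ˢ-weaken⁺ Δ ≈-refl s

⟦⟧ˢ-exts⁻ : ∀ {m n} {σ : Fin m → Term n} Δ {D P Γ} →
            ⟦ exts σ ⟧ˢ (P ∷ Γ) (D ∷ Δ) → D ≈ P × ⟦ σ ⟧ˢ Γ Δ
⟦⟧ˢ-exts⁻ Δ (_ ∷ _ , _ ∷ _ , P≈ ∷ Γ≈ , d , s) with ⟦var⟧⁻ d | ⟦⟧ˢ-weaken⁻ Δ s
... | P₁≈D ∷ Γ₁≈𝟘 | P₂≈𝟘 , s′ =
  ≈-trans (≈-sym P₁≈D) (≈-sym (≈-⊎ₚ-𝟘ʳ P≈ P₂≈𝟘)) , ⟦⟧ˢ-respˡ Δ (≈ₑ-sym (≈ₑ-⊎ₑ-𝟘ˡ Γ≈ Γ₁≈𝟘)) s′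

⟦⟧ˢ-exts⁺ : ∀ {m n} {σ : Fin m → Term n} Δ {P Γ} → ⟦ σ ⟧ˢ Γ Δ → ⟦ exts σ ⟧ˢ (P ∷ Γ) (P ∷ Δ)
⟦⟧ˢ-exts⁺ Δ {P} {Γ} s =
  P ∷ 𝟘ₑ , 𝟘 ∷ Γ , ≈-sym (⊎ₚ-identityʳ P) ∷ ≈ₑ-sym (⊎ₑ-identityˡ Γ) , ⟦var⟧⁺ ≈ₑ-refl ,
  ⟦⟧ˢ-weaken⁺ Δ ≈-refl s

mutual
  ⟦subst⟧⁻ : ∀ {m n} {σ : Fin m → Term n} → Values σ → ∀ t {Γ Q} →
             ⟦ subst σ t ⟧ Γ Q → ∃[ Δ ] (⟦ σ ⟧ˢ Γ Δ × ⟦ t ⟧ Δ Q)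
  ⟦subst⟧⁻ vs (var i) {Q = Q} x = 𝟘ₑ [ i ]≔ Q , ⟦⟧ˢ-upd⁺ vs i x , ⟦var⟧⁺ ≈ₑ-refl
  ⟦subst⟧⁻ vs (t · u) x with ⟦·⟧⁻ x
  ... | _ , _ , _ , Γ≈ , dt , du with ⟦subst⟧⁻ vs t dt | ⟦subst⟧⁻ vs u du
  ... | Δ₁ , s₁ , dt′ | Δ₂ , s₂ , du′ =
    Δ₁ ⊎ₑ Δ₂ , ⟦⟧ˢ-⊎ₑ⁺ vs Δ₁ Δ₂ Γ≈ s₁ s₂ , ⟦·⟧⁺ ≈ₑ-refl dt′ du′
  ⟦subst⟧⁻ vs (ƛ t) {Q = mset ps} x with ⟦subst⟧ˡ⁻ vs t ps (⟦ƛ⟧⁻ x)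
  ... | Δ , s , l = Δ , s , ⟦ƛ⟧⁺ l

  ⟦subst⟧ˡ⁻ : ∀ {m n} {σ : Fin m → Term n} → Values σ → ∀ t ps {Γ} →
              ⟦ subst (exts σ) t ⟧ˡ Γ ps → ∃[ Δ ] (⟦ σ ⟧ˢ Γ Δ × ⟦ t ⟧ˡ Δ ps)
  ⟦subst⟧ˡ⁻ vs t []       Γ≈𝟘 = 𝟘ₑ , ⟦⟧ˢ-𝟘⁺ vs Γ≈𝟘 , ≈ₑ-refl
  ⟦subst⟧ˡ⁻ vs t (_ ∷ ps) (_ , _ , Γ≈ , d , l) with ⟦subst⟧⁻ (Values-exts vs) t d
  ... | _ ∷ Δ₁ , s , d′ with ⟦⟧ˢ-exts⁻ Δ₁ s | ⟦subst⟧ˡ⁻ vs t ps l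
  ... | D≈P , s₁ | Δ₂ , s₂ , l′ =
    Δ₁ ⊎ₑ Δ₂ , ⟦⟧ˢ-⊎ₑ⁺ vs Δ₁ Δ₂ Γ≈ s₁ s₂ , (Δ₁ , Δ₂ , ≈ₑ-refl , ⟦⟧-respₑ (D≈P ∷ ≈ₑ-refl) d′ , l′)

mutual
  ⟦subst⟧⁺ : ∀ {m n} {σ : Fin m → Term n} → Values σ → ∀ t {Γ Δ Q} →
             ⟦ σ ⟧ˢ Γ Δ → ⟦ t ⟧ Δ Q → ⟦ subst σ t ⟧ Γ Q
  ⟦subst⟧⁺ vs (var i) s x = ⟦⟧ˢ-upd⁻ vs i (⟦⟧ˢ-respʳ (⟦var⟧⁻ x) s)
  ⟦subst⟧⁺ vs (t · u) s x with ⟦·⟧⁻ x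
  ... | Δ₁ , Δ₂ , _ , Δ≈ , dt , du with ⟦⟧ˢ-⊎ₑ⁻ vs Δ₁ Δ₂ (⟦⟧ˢ-respʳ Δ≈ s)
  ... | _ , _ , Γ≈ , s₁ , s₂ = ⟦·⟧⁺ Γ≈ (⟦subst⟧⁺ vs t s₁ dt) (⟦subst⟧⁺ vs u s₂ du)
  ⟦subst⟧⁺ vs (ƛ t) {Q = mset ps} s x = ⟦ƛ⟧⁺ (⟦subst⟧ˡ⁺ vs t ps s (⟦ƛ⟧⁻ x))

  ⟦subst⟧ˡ⁺ : ∀ {m n} {σ : Fin m → Term n} → Values σ → ∀ t ps {Γ Δ} →
              ⟦ σ ⟧ˢ Γ Δ → ⟦ t ⟧ˡ Δ ps → ⟦ subst (exts σ) t ⟧ˡ Γ ps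
  ⟦subst⟧ˡ⁺ vs t []       s Δ≈𝟘 = ⟦⟧ˢ-𝟘⁻ vs (⟦⟧ˢ-respʳ Δ≈𝟘 s)
  ⟦subst⟧ˡ⁺ vs t (_ ∷ ps) s (Δ₁ , Δ₂ , Δ≈ , d , l) with ⟦⟧ˢ-⊎ₑ⁻ vs Δ₁ Δ₂ (⟦⟧ˢ-respʳ Δ≈ s)
  ... | Γ₁ , Γ₂ , Γ≈ , s₁ , s₂ =
    Γ₁ , Γ₂ , Γ≈ , ⟦subst⟧⁺ (Values-exts vs) t (⟦⟧ˢ-exts⁺ Δ₁ s₁) d , ⟦subst⟧ˡ⁺ vs t ps s₂ l

⟦var∘⟧ˢ⁻ : ∀ {m n} (ρ : Fin m → Fin n) Δ {Γ} → ⟦ var ∘ ρ ⟧ˢ Γ Δ → Γ ≈ₑ pushₑ ρ Δ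
⟦var∘⟧ˢ⁻ ρ []      Γ≈𝟘                    = Γ≈𝟘
⟦var∘⟧ˢ⁻ ρ (_ ∷ Δ) (_ , _ , Γ≈ , d , s) = ≈ₑ-trans Γ≈ (⊎ₑ-cong (⟦var⟧⁻ d) (⟦var∘⟧ˢ⁻ (ρ ∘ suc) Δ s))

⟦var∘⟧ˢ⁺ : ∀ {m n} (ρ : Fin m → Fin n) Δ → ⟦ var ∘ ρ ⟧ˢ (pushₑ ρ Δ) Δ
⟦var∘⟧ˢ⁺ ρ []      = ≈ₑ-refl
⟦var∘⟧ˢ⁺ ρ (_ ∷ Δ) = _ , _ , ≈ₑ-refl , ⟦var⟧⁺ ≈ₑ-refl , ⟦var∘⟧ˢ⁺ (ρ ∘ suc) Δ

⟦⟨⟩⟧⁻ : ∀ {n} (t : Term (suc n)) {v : Term n} → Value v → ∀ {Γ Q} → ⟦ t ⟨ v ⟩ ⟧ Γ Q →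
        ∃[ Γ₁ ] ∃[ Γ₂ ] ∃[ P ] (Γ ≈ₑ (Γ₁ ⊎ₑ Γ₂) × ⟦ t ⟧ (P ∷ Γ₁) Q × ⟦ v ⟧ Γ₂ P)
⟦⟨⟩⟧⁻ t vv x with ⟦subst⟧⁻ (λ { zero → vv ; (suc i) → var-val i }) t x
... | P ∷ Δ , (Γ₂ , Γ₁ , Γ≈ , dv , s) , d =
  Γ₁ , Γ₂ , P , ≈ₑ-trans Γ≈ (⊎ₑ-comm Γ₂ Γ₁) ,
  ⟦⟧-respₑ (≈-refl ∷ ≈ₑ-sym (≈ₑ-trans (⟦var∘⟧ˢ⁻ id Δ s) (pushₑ-id Δ))) d , dv

⟦⟨⟩⟧⁺ : ∀ {n} (t : Term (suc n)) {v : Term n} → Value v → ∀ {Γ Γ₁ Γ₂ P Q} →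
        Γ ≈ₑ (Γ₁ ⊎ₑ Γ₂) → ⟦ t ⟧ (P ∷ Γ₁) Q → ⟦ v ⟧ Γ₂ P → ⟦ t ⟨ v ⟩ ⟧ Γ Q
⟦⟨⟩⟧⁺ t vv {Γ₁ = Γ₁} {Γ₂} Γ≈ d dv =
  ⟦subst⟧⁺ (λ { zero → vv ; (suc i) → var-val i }) t
    (Γ₂ , Γ₁ , ≈ₑ-trans Γ≈ (⊎ₑ-comm Γ₁ Γ₂) , dv , ⟦⟧ˢ-respˡ Γ₁ (pushₑ-id Γ₁) (⟦var∘⟧ˢ⁺ id Γ₁)) d

_≅_ : ∀ {n} → Term n → Term n → Set
t ≅ u = ∀ Γ Q → ⟦ t ⟧ Γ Q ⇔ ⟦ u ⟧ Γ Q

≲-antisym : ∀ {n} {t u : Term n} → t ≲ u → u ≲ t → t ≅ u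
≲-antisym t≲u u≲t Γ Q = mk⇔ t≲u u≲t

≅⇒≲ : ∀ {n} {t u : Term n} → t ≅ u → t ≲ u
≅⇒≲ t≅u = Equivalence.to (t≅u _ _)

≅⇒≳ : ∀ {n} {t u : Term n} → t ≅ u → u ≲ t
≅⇒≳ t≅u = Equivalence.from (t≅u _ _)

≅-isEquivalence : ∀ {n} → IsEquivalence (_≅_ {n})
≅-isEquivalence = record
  { refl  = λ Γ Q → ⇔.refl
  ; sym   = λ t≅u Γ Q → ⇔.sym (t≅u Γ Q)
  ; trans = λ t≅u u≅v Γ Q → ⇔.trans (t≅u Γ Q) (u≅v Γ Q)
  }
  where module ⇔ = IsEquivalence ⇔-isEquivalence

ƛ-cong : ∀ {n} {t t′ : Term (suc n)} → t ≅ t′ → (ƛ t) ≅ (ƛ t′)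
ƛ-cong t≅t′ = ≲-antisym (ƛ-mono (≅⇒≲ t≅t′)) (ƛ-mono (≅⇒≳ t≅t′))

·-congˡ : ∀ {n} {t t′ u : Term n} → t ≅ t′ → (t · u) ≅ (t′ · u)
·-congˡ t≅t′ = ≲-antisym (·-monoˡ (≅⇒≲ t≅t′)) (·-monoˡ (≅⇒≳ t≅t′))

·-congʳ : ∀ {n} {t u u′ : Term n} → u ≅ u′ → (t · u) ≅ (t · u′)
·-congʳ u≅u′ = ≲-antisym (·-monoʳ (≅⇒≲ u≅u′)) (·-monoʳ (≅⇒≳ u≅u′))

βv-sound : ∀ {n} (t : Term (suc n)) (v : Term n) → Value v → ((ƛ t) · v) ≅ (t ⟨ v ⟩)
βv-sound t v vv = ≲-antisym contract expand
  where
  contract : ((ƛ t) · v) ≲ (t ⟨ v ⟩)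
  contract x with ⟦·⟧⁻ x
  ... | _ , _ , _ , Γ≈ , dλ , dv = ⟦⟨⟩⟧⁺ t vv Γ≈ (⟦ƛ⟧¹⁻ dλ) dv

  expand : (t ⟨ v ⟩) ≲ ((ƛ t) · v)
  expand x with ⟦⟨⟩⟧⁻ t vv x
  ... | _ , _ , _ , Γ≈ , d , dv = ⟦·⟧⁺ Γ≈ (⟦ƛ⟧¹⁺ d) dv

σ₁-sound : ∀ {n} (t : Term (suc n)) (u s : Term n) → ((ƛ t) · u · s) ≅ ((ƛ (t · weaken s)) · u)
σ₁-sound t u s = ≲-antisym shift unshift
  where
  shift : ((ƛ t) · u · s) ≲ ((ƛ (t · weaken s)) · u)
  shift x with ⟦·⟧⁻ x
  ... | _ , Γs , _ , Γ≈ , dtu , ds with ⟦·⟧⁻ dtu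
  ... | Γt , Γu , P , Γtu≈ , dλ , du =
    ⟦·⟧⁺ (≈ₑ-trans Γ≈ (≈ₑ-trans (⊎ₑ-cong Γtu≈ ≈ₑ-refl) (⊎ₑ-rightSwap Γt Γu Γs)))
         (⟦ƛ⟧¹⁺ (⟦·⟧⁺ (≈-sym (⊎ₚ-identityʳ P) ∷ ≈ₑ-refl) (⟦ƛ⟧¹⁻ dλ) (⟦weaken⟧⁺ s ≈-refl ds)))
         du

  unshift : ((ƛ (t · weaken s)) · u) ≲ ((ƛ t) · u · s)
  unshift x with ⟦·⟧⁻ x
  ... | _ , Γu , _ , Γ≈ , dλ , du with ⟦·⟧⁻ (⟦ƛ⟧¹⁻ dλ)
  ... | _ ∷ Γt , _ ∷ Γs , _ , P≈ ∷ Γts≈ , dt , dws with ⟦weaken⟧⁻ s dws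
  ... | P₂≈𝟘 , ds =
    ⟦·⟧⁺ (≈ₑ-trans Γ≈ (≈ₑ-trans (⊎ₑ-cong Γts≈ ≈ₑ-refl) (⊎ₑ-rightSwap Γt Γs Γu)))
         (⟦·⟧⁺ ≈ₑ-refl (⟦ƛ⟧¹⁺ (⟦⟧-respₑ (≈-sym (≈-⊎ₚ-𝟘ʳ P≈ P₂≈𝟘) ∷ ≈ₑ-refl) dt)) du)
         ds

σ₃-sound : ∀ {n} (v : Term n) (s : Term (suc n)) (u : Term n) →
           (v · ((ƛ s) · u)) ≅ ((ƛ (weaken v · s)) · u)
σ₃-sound v s u = ≲-antisym shift unshift
  where
  shift : (v · ((ƛ s) · u)) ≲ ((ƛ (weaken v · s)) · u)
  shift x with ⟦·⟧⁻ x
  ... | Γv , _ , _ , Γ≈ , dv , dsu with ⟦·⟧⁻ dsu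
  ... | Γs , Γu , P , Γsu≈ , dλ , du =
    ⟦·⟧⁺ (≈ₑ-trans Γ≈ (≈ₑ-trans (⊎ₑ-cong ≈ₑ-refl Γsu≈) (≈ₑ-sym (⊎ₑ-assoc Γv Γs Γu))))
         (⟦ƛ⟧¹⁺ (⟦·⟧⁺ (≈-sym (⊎ₚ-identityˡ P) ∷ ≈ₑ-refl) (⟦weaken⟧⁺ v ≈-refl dv) (⟦ƛ⟧¹⁻ dλ)))
         du

  unshift : ((ƛ (weaken v · s)) · u) ≲ (v · ((ƛ s) · u))
  unshift x with ⟦·⟧⁻ x
  ... | _ , Γu , _ , Γ≈ , dλ , du with ⟦·⟧⁻ (⟦ƛ⟧¹⁻ dλ)
  ... | _ ∷ Γv , _ ∷ Γs , _ , P≈ ∷ Γvs≈ , dwv , ds with ⟦weaken⟧⁻ v dwv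
  ... | P₁≈𝟘 , dv =
    ⟦·⟧⁺ (≈ₑ-trans Γ≈ (≈ₑ-trans (⊎ₑ-cong Γvs≈ ≈ₑ-refl) (⊎ₑ-assoc Γv Γs Γu)))
         dv
         (⟦·⟧⁺ ≈ₑ-refl (⟦ƛ⟧¹⁺ (⟦⟧-respₑ (≈-sym (≈-⊎ₚ-𝟘ˡ P≈ P₁≈𝟘) ∷ ≈ₑ-refl) ds)) du)

↦-sound : ∀ {n} {t u : Term n} → t ↦ u → t ≅ u
↦-sound (βv t v vv)   = βv-sound t v vv
↦-sound (σ₁ t u s)    = σ₁-sound t u s
↦-sound (σ₃ v s u _)  = σ₃-sound v s u

→shuf-sound : ∀ {n} {t u : Term n} → t →shuf u → t ≅ u
→shuf-sound (root r) = ↦-sound r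
→shuf-sound (ξλ r)   = ƛ-cong (→shuf-sound r)
→shuf-sound (ξ·l r)  = ·-congˡ (→shuf-sound r)
→shuf-sound (ξ·r r)  = ·-congʳ (→shuf-sound r)

≃shuf-sound : ∀ {n} {t u : Term n} → t ≃shuf u → t ≅ u
≃shuf-sound = fold ≅-isEquivalence →shuf-sound

mainTheorem5 : (k : ℕ) (t u : Term k) → t ≃shuf u →
    (Γ : Env k) (Q : Pos) → ⟦ t ⟧ Γ Q ⇔ ⟦ u ⟧ Γ Q
mainTheorem5 k t u t≃u = ≃shuf-sound t≃u
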